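{- Let $T$ be a complete theory. If every partitioned formula $\varphi(x; \overline{y})$ in which $x$ is a single variable has UDTFS, then $T$ has UDTFS (i.e. every partitioned formula $\varphi(\overline{x};\overline{y})$ has UDTFS).
   Context: Work in a monster model $\mathfrak{C}$ of $T$; formulas are $\emptyset$-definable. For $B \subseteq \mathfrak{C}^{\mathrm{lg}(\overline{y})}$, $S_\varphi(B)$ is the set of $\varphi$-types over $B$: maximal consistent sets of formulas $\varphi(\overline{x};\overline{b})$ or $\neg\varphi(\overline{x};\overline{b})$ with $\overline{b}\in B$. A formula $\psi(\overline{y})$ (possibly with parameters) defines $p\in S_\varphi(B)$ if for all $\overline{b}\in B$, $\models\psi(\overline{b})$ iff $\varphi(\overline{x};\overline{b})\in p$. A partitioned formula $\varphi(\overline{x};\overline{y})$ has UDTFS if there is a formula $\psi(\overline{y}; \overline{z}_0,\dots,\overline{z}_{k-1})$ such that for every finite set $B$ of $\mathrm{lg}(\overline{y})$-tuples with $|B|\ge 2$ and every $p\in S_\varphi(B)$ there are $\overline{c}_0,\dots,\overline{c}_{k-1}\in B$ such that $\psi(\overline{y};\overline{c}_0,\dots,\overline{c}_{k-1})$ defines $p$. A theory has UDTFS if every partitioned formula has UDTFS. -}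

module Defs where

open import Level using (0ℓ)
open import Data.Nat using (ℕ; suc; _+_; _*_; _≤_)
open import Data.Fin using (Fin)
open import Data.Vec using (Vec; _∷_; []; lookup; _++_; concat; map)
open import Data.List using (List; length)
open import Data.List.Membership.Propositional using (_∈_)
open import Data.List.Relation.Unary.Unique.Propositional using (Unique)
open import Data.Empty using (⊥)
open import Data.Unit using (⊤)
open import Data.Product using (Σ; _×_; ∃-syntax)
open import Data.Sum using (_⊎_)
open import Relation.Binary.PropositionalEquality using (_≡_)
open import Function.Bundles using (_⇔_)

record Language : Set₁ where
  field
    Func : ℕ → Set
    Rel  : ℕ → Set

module _ (L : Language) where
  open Language L

  -- terms / formulas in the variables Fin n; no parameters, i.e. ∅-definable
  data Term (n : ℕ) : Set where
    var : Fin n → Term n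
    app : ∀ {k} → Func k → Vec (Term n) k → Term n

  data Formula : ℕ → Set where
    ⊤'  : ∀ {n} → Formula n
    ⊥'  : ∀ {n} → Formula n
    _≐_ : ∀ {n} → Term n → Term n → Formula n
    rel : ∀ {n k} → Rel k → Vec (Term n) k → Formula n
    ¬'_ : ∀ {n} → Formula n → Formula n
    _∧'_ : ∀ {n} → Formula n → Formula n → Formula n
    _∨'_ : ∀ {n} → Formula n → Formula n → Formula n
    _⇒'_ : ∀ {n} → Formula n → Formula n → Formula n
    ∀'  : ∀ {n} → Formula (suc n) → Formula n
    ∃'  : ∀ {n} → Formula (suc n) → Formula n

  record Structure : Set₁ where
    field
      Carrier : Set
      point   : Carrier
      funcᴹ   : ∀ {k} → Func k → Vec Carrier k → Carrier
      relᴹ    : ∀ {k} → Rel k → Vec Carrier k → Set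

  module _ (M : Structure) where
    open Structure M

    evalTerm : ∀ {n} → Vec Carrier n → Term n → Carrier
    evalTerms : ∀ {n k} → Vec Carrier n → Vec (Term n) k → Vec Carrier k
    evalTerm ρ (var i) = lookup ρ i
    evalTerm ρ (app f ts) = funcᴹ f (evalTerms ρ ts)
    evalTerms ρ [] = []
    evalTerms ρ (t ∷ ts) = evalTerm ρ t ∷ evalTerms ρ ts

    Sat : ∀ {n} → Formula n → Vec Carrier n → Set
    Sat ⊤' ρ = ⊤
    Sat ⊥' ρ = ⊥
    Sat (s ≐ t) ρ = evalTerm ρ s ≡ evalTerm ρ t
    Sat (rel r ts) ρ = relᴹ r (evalTerms ρ ts)
    Sat (¬' φ) ρ = Sat φ ρ → ⊥
    Sat (φ ∧' ψ) ρ = Sat φ ρ × Sat ψ ρ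
    Sat (φ ∨' ψ) ρ = Sat φ ρ ⊎ Sat ψ ρ
    Sat (φ ⇒' ψ) ρ = Sat φ ρ → Sat ψ ρ
    Sat (∀' φ) ρ = (a : Carrier) → Sat φ (a ∷ ρ)
    Sat (∃' φ) ρ = Σ Carrier (λ a → Sat φ (a ∷ ρ))

    -- A partitioned formula φ(x̄;ȳ) with lg x̄ = n, lg ȳ = m is a
    -- Formula (n + m); variables 0..n-1 are x̄, n..n+m-1 are ȳ.
    -- A finite set B of m-tuples is a duplicate-free list.
    -- The φ-type over finite B of ā ∈ M^n is tp_φ(ā/B); every element of
    -- S_φ(B) (B finite) is of this form.
    -- ψ(ȳ; z̄₀,…,z̄_{k-1}) is a Formula (m + k * m).

    Defines : ∀ {n m k} → Formula (n + m) → Formula (m + k * m)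
            → Vec (Vec Carrier m) k → List (Vec Carrier m) → Vec Carrier n → Set
    Defines φ ψ cs B a =
      ∀ b → b ∈ B → (Sat ψ (b ++ concat cs) ⇔ Sat φ (a ++ b))

    UDTFS : (n m : ℕ) → Formula (n + m) → Set
    UDTFS n m φ =
      Σ ℕ λ k → Σ (Formula (m + k * m)) λ ψ →
        ∀ (B : List (Vec Carrier m)) → Unique B → 2 ≤ length B →
        ∀ (a : Vec Carrier n) →
        ∃[ cs ] ((∀ i → lookup cs i ∈ B) × Defines {n} {m} {k} φ ψ cs B a)

-- Induction on the length of x̄, splitting off one variable at a time. Read φ(x₀x̄; ȳ) as a
-- formula in the single variable x₀ with parameters x̄ȳ. For a tuple a₀ā, the φ-type of a₀
-- over āB = {āb̄ : b̄ ∈ B} is defined by some ψ(āȳ; āc̄₁, …, āc̄ₖ) with c̄ᵢ ∈ B, i.e. by a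
-- formula χ(x̄; ȳc̄₁…c̄ₖ) with fewer object variables. By induction the χ-type of ā over
-- {b̄c̄₁…c̄ₖ : b̄ ∈ B} is defined by some ψ₂(ȳc̄₁…c̄ₖ; d̄₁c̄₁…c̄ₖ, …, d̄ₗc̄₁…c̄ₖ) with d̄ⱼ ∈ B,
-- a formula in ȳ with the k + l parameters c̄₁ … c̄ₖ d̄₁ … d̄ₗ from B. Both images of B are
-- again finite sets with at least two elements because the maps b̄ ↦ āb̄, b̄ ↦ b̄c̄ are injective.

module Submission where

open import Defs
open import Level using (0ℓ)
open import Axiom.ExcludedMiddle using (ExcludedMiddle)
open import Data.Nat using (ℕ; zero; suc; _+_; _*_; _≤_)
open import Data.Fin using (Fin; zero; suc)
open import Data.Vec using (Vec; []; _∷_; _++_; concat; map; lookup; take; drop; allFin)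
open import Data.Vec.Properties
  using ( take-map; drop-map; take++drop≡id; ++-injectiveˡ; ++-injectiveʳ
        ; map-++; map-concat; map-∘; map-cong; lookup-map; map-lookup-allFin)
import Data.List as List
open import Data.List using (List; length)
open import Data.List.Properties using (length-map)
open import Data.List.Membership.Propositional using (_∈_)
open import Data.List.Membership.Propositional.Properties using (∈-map⁺; ∈-map⁻)
open import Data.List.Relation.Unary.Unique.Propositional using (Unique)
import Data.List.Relation.Unary.Unique.Propositional.Properties as Unique
open import Data.Product using (_×_; _,_; ∃-syntax)
open import Data.Product.Function.NonDependent.Propositional using (_×-⇔_)
open import Data.Sum.Function.Propositional using (_⊎-⇔_)
open import Function.Bundles using (_⇔_; mk⇔; Equivalence)
open import Function.Construct.Identity using (⇔-id)
open import Function.Definitions using (Injective)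
open import Function.Properties.Equivalence using () renaming (trans to ⇔-trans)
open import Function.Related.Propositional using (≡⇒; module EquationalReasoning)
open import Function.Related.TypeIsomorphisms using (→-cong-⇔; ¬-cong-⇔)
open import Relation.Binary.PropositionalEquality
  using (_≡_; refl; sym; trans; cong; cong₂; subst; module ≡-Reasoning)

private variable
  X Y : Set
  a b k k₂ m m′ n : ℕ

take-++ : (xs : Vec X m) (ys : Vec X n) → take m (xs ++ ys) ≡ xs
take-++ {m = m} xs ys = ++-injectiveˡ _ xs (take++drop≡id m (xs ++ ys))

drop-++ : (xs : Vec X m) (ys : Vec X n) → drop m (xs ++ ys) ≡ ys
drop-++ {m = m} xs ys = ++-injectiveʳ _ xs (take++drop≡id m (xs ++ ys))

chunks : ∀ k m → Vec X (k * m) → Vec (Vec X m) k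
chunks zero    m xs = []
chunks (suc k) m xs = take m xs ∷ chunks k m (drop m xs)

chunks-concat : (xss : Vec (Vec X m) k) → chunks k m (concat xss) ≡ xss
chunks-concat []         = refl
chunks-concat (xs ∷ xss) rewrite take-++ xs (concat xss) | drop-++ xs (concat xss) =
  cong (xs ∷_) (chunks-concat xss)

chunks-map : ∀ k m (g : X → Y) (xs : Vec X (k * m)) →
             chunks k m (map g xs) ≡ map (map g) (chunks k m xs)
chunks-map zero    m g xs = refl
chunks-map (suc k) m g xs rewrite take-map g m xs | drop-map g m xs =
  cong (map g (take m xs) ∷_) (chunks-map k m g (drop m xs))

map-map-++ˡ : (g : X → Y) (xs : Vec X n) (yss : Vec (Vec X m) k) →
              map (map g) (map (xs ++_) yss) ≡ map (map g xs ++_) (map (map g) yss)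
map-map-++ˡ g xs yss = trans (sym (map-∘ (map g) (xs ++_) yss))
  (trans (map-cong (map-++ g xs) yss) (map-∘ (map g xs ++_) (map g) yss))

map-map-++ʳ : (g : X → Y) (xs : Vec X n) (yss : Vec (Vec X m) k) →
              map (map g) (map (_++ xs) yss) ≡ map (_++ map g xs) (map (map g) yss)
map-map-++ʳ g xs yss = trans (sym (map-∘ (map g) (_++ xs) yss))
  (trans (map-cong (λ ys → map-++ g ys xs) yss) (map-∘ (_++ map g xs) (map g) yss))

lookups-∈-map⁻ : (f : X → Y) {xs : List X} (ys : Vec Y k) →
                 (∀ i → lookup ys i ∈ List.map f xs) →
                 ∃[ zs ] ((∀ i → lookup zs i ∈ xs) × ys ≡ map f zs)
lookups-∈-map⁻ f []       _   = [] , (λ ()) , refl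
lookups-∈-map⁻ f (y ∷ ys) ys∈ with ∈-map⁻ f (ys∈ zero) | lookups-∈-map⁻ f ys (λ i → ys∈ (suc i))
... | z , z∈ , refl | zs , zs∈ , refl = z ∷ zs , (λ { zero → z∈ ; (suc i) → zs∈ i }) , refl

lookup-++⁺ : (P : X → Set) (xs : Vec X m) (ys : Vec X n) →
             (∀ i → P (lookup xs i)) → (∀ i → P (lookup ys i)) → ∀ i → P (lookup (xs ++ ys) i)
lookup-++⁺ P []       ys P-xs P-ys i       = P-ys i
lookup-++⁺ P (x ∷ xs) ys P-xs P-ys zero    = P-xs zero
lookup-++⁺ P (x ∷ xs) ys P-xs P-ys (suc i) = lookup-++⁺ P xs ys (λ j → P-xs (suc j)) P-ys i

-- A natural reindexing f is determined by the positions f (allFin b) it picks, so it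
-- can be carried out on formulas by renaming variables.
Reindexing : ℕ → ℕ → Set₁
Reindexing a b = ∀ {X : Set} → Vec X b → Vec X a

Natural : Reindexing a b → Set₁
Natural f = ∀ {X Y : Set} (g : X → Y) xs → map g (f xs) ≡ f (map g xs)

take-natural : Natural (take m {n})
take-natural {m = m} g xs = sym (take-map g m xs)

prependToBlocks : ∀ n m k → Reindexing ((n + m) + k * (n + m)) (n + (m + k * m))
prependToBlocks n m k v = (xs ++ ys) ++ concat (map (xs ++_) (chunks k m zs))
  where
  xs = take n v
  ys = take m (drop n v)
  zs = drop m (drop n v)

prependToBlocks-++ : (xs : Vec X n) (ys : Vec X m) (zss : Vec (Vec X m) k) →
  prependToBlocks n m k (xs ++ (ys ++ concat zss)) ≡ (xs ++ ys) ++ concat (map (xs ++_) zss)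
prependToBlocks-++ xs ys zss
  rewrite take-++ xs (ys ++ concat zss) | drop-++ xs (ys ++ concat zss)
        | take-++ ys (concat zss) | drop-++ ys (concat zss) | chunks-concat zss = refl

prependToBlocks-natural : Natural (prependToBlocks n m k)
prependToBlocks-natural {n = n} {m = m} {k = k} g v
  rewrite take-map g n v | drop-map g n v | take-map g m (drop n v) | drop-map g m (drop n v)
        | chunks-map k m g (drop m (drop n v))
  = begin
    map g ((xs ++ ys) ++ concat (map (xs ++_) zss))
      ≡⟨ map-++ g (xs ++ ys) (concat (map (xs ++_) zss)) ⟩
    map g (xs ++ ys) ++ map g (concat (map (xs ++_) zss))
      ≡⟨ cong₂ _++_ (map-++ g xs ys) (map-concat g (map (xs ++_) zss)) ⟩
    (map g xs ++ map g ys) ++ concat (map (map g) (map (xs ++_) zss))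
      ≡⟨ cong (λ t → (map g xs ++ map g ys) ++ concat t) (map-map-++ˡ g xs zss) ⟩
    (map g xs ++ map g ys) ++ concat (map (map g xs ++_) (map (map g) zss)) ∎
  where
  open ≡-Reasoning
  xs = take n v
  ys = take m (drop n v)
  zss = chunks k m (drop m (drop n v))

appendToBlocks : ∀ m k k₂ → Reindexing ((m + k * m) + k₂ * (m + k * m)) (m + (k + k₂) * m)
appendToBlocks m k k₂ v = (ys ++ concat xss) ++ concat (map (_++ concat xss) zss)
  where
  ys = take m v
  xss = take k (chunks (k + k₂) m (drop m v))
  zss = drop k (chunks (k + k₂) m (drop m v))

appendToBlocks-++ : (ys : Vec X m) (xss : Vec (Vec X m) k) (zss : Vec (Vec X m) k₂) →
  appendToBlocks m k k₂ (ys ++ concat (xss ++ zss))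
    ≡ (ys ++ concat xss) ++ concat (map (_++ concat xss) zss)
appendToBlocks-++ ys xss zss
  rewrite take-++ ys (concat (xss ++ zss)) | drop-++ ys (concat (xss ++ zss))
        | chunks-concat (xss ++ zss) | take-++ xss zss | drop-++ xss zss = refl

appendToBlocks-natural : Natural (appendToBlocks m k k₂)
appendToBlocks-natural {m = m} {k = k} {k₂ = k₂} g v
  rewrite take-map g m v | drop-map g m v | chunks-map (k + k₂) m g (drop m v)
        | take-map (map g) k (chunks (k + k₂) m (drop m v))
        | drop-map (map g) k (chunks (k + k₂) m (drop m v))
  = begin
    map g ((ys ++ concat xss) ++ concat (map (_++ concat xss) zss))
      ≡⟨ map-++ g (ys ++ concat xss) (concat (map (_++ concat xss) zss)) ⟩
    map g (ys ++ concat xss) ++ map g (concat (map (_++ concat xss) zss))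
      ≡⟨ cong₂ _++_ (map-++ g ys (concat xss)) (map-concat g (map (_++ concat xss) zss)) ⟩
    (map g ys ++ map g (concat xss)) ++ concat (map (map g) (map (_++ concat xss) zss))
      ≡⟨ cong (λ t → (map g ys ++ map g (concat xss)) ++ concat t) (map-map-++ʳ g (concat xss) zss) ⟩
    (map g ys ++ map g (concat xss)) ++ concat (map (_++ map g (concat xss)) (map (map g) zss))
      ≡⟨ cong (λ s → (map g ys ++ s) ++ concat (map (_++ s) (map (map g) zss))) (map-concat g xss) ⟩
    (map g ys ++ concat (map (map g) xss))
      ++ concat (map (_++ concat (map (map g) xss)) (map (map g) zss)) ∎
  where
  open ≡-Reasoning
  ys = take m v
  xss = take k (chunks (k + k₂) m (drop m v))
  zss = drop k (chunks (k + k₂) m (drop m v))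

module _ {L : Language} where

  renameTerm : Vec (Fin b) a → Term L a → Term L b
  renameTerms : Vec (Fin b) a → Vec (Term L a) k → Vec (Term L b) k
  renameTerm σ (var i)    = var (lookup σ i)
  renameTerm σ (app f ts) = app f (renameTerms σ ts)
  renameTerms σ []       = []
  renameTerms σ (t ∷ ts) = renameTerm σ t ∷ renameTerms σ ts

  lift : Vec (Fin b) a → Vec (Fin (suc b)) (suc a)
  lift σ = zero ∷ map suc σ

  rename : Vec (Fin b) a → Formula L a → Formula L b
  rename σ ⊤'         = ⊤'
  rename σ ⊥'         = ⊥'
  rename σ (s ≐ t)    = renameTerm σ s ≐ renameTerm σ t
  rename σ (rel r ts) = rel r (renameTerms σ ts)
  rename σ (¬' φ)     = ¬' rename σ φ
  rename σ (φ ∧' ψ)   = rename σ φ ∧' rename σ ψ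
  rename σ (φ ∨' ψ)   = rename σ φ ∨' rename σ ψ
  rename σ (φ ⇒' ψ)   = rename σ φ ⇒' rename σ ψ
  rename σ (∀' φ)     = ∀' (rename (lift σ) φ)
  rename σ (∃' φ)     = ∃' (rename (lift σ) φ)

  reindex : Reindexing a b → Formula L a → Formula L b
  reindex {b = b} f = rename (f (allFin b))

  module _ (M : Structure L) where
    open Structure M
    open Equivalence using (to; from)

    evalTerm-rename : (σ : Vec (Fin b) a) (ρ : Vec Carrier b) (t : Term L a) →
                      evalTerm L M ρ (renameTerm σ t) ≡ evalTerm L M (map (lookup ρ) σ) t
    evalTerms-rename : (σ : Vec (Fin b) a) (ρ : Vec Carrier b) (ts : Vec (Term L a) k) →
                       evalTerms L M ρ (renameTerms σ ts) ≡ evalTerms L M (map (lookup ρ) σ) ts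
    evalTerm-rename σ ρ (var i)    = sym (lookup-map i (lookup ρ) σ)
    evalTerm-rename σ ρ (app f ts) = cong (funcᴹ f) (evalTerms-rename σ ρ ts)
    evalTerms-rename σ ρ []       = refl
    evalTerms-rename σ ρ (t ∷ ts) = cong₂ _∷_ (evalTerm-rename σ ρ t) (evalTerms-rename σ ρ ts)

    Sat-rename : (σ : Vec (Fin b) a) (φ : Formula L a) (ρ : Vec Carrier b) →
                 Sat L M (rename σ φ) ρ ⇔ Sat L M φ (map (lookup ρ) σ)
    Sat-rename-lift : (σ : Vec (Fin b) a) (φ : Formula L (suc a)) (ρ : Vec Carrier b) (c : Carrier) →
                      Sat L M (rename (lift σ) φ) (c ∷ ρ) ⇔ Sat L M φ (c ∷ map (lookup ρ) σ)

    Sat-rename σ ⊤'         ρ = ⇔-id _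
    Sat-rename σ ⊥'         ρ = ⇔-id _
    Sat-rename σ (s ≐ t)    ρ = ≡⇒ (cong₂ _≡_ (evalTerm-rename σ ρ s) (evalTerm-rename σ ρ t))
    Sat-rename σ (rel r ts) ρ = ≡⇒ (cong (relᴹ r) (evalTerms-rename σ ρ ts))
    Sat-rename σ (¬' φ)     ρ = ¬-cong-⇔ (Sat-rename σ φ ρ)
    Sat-rename σ (φ ∧' ψ)   ρ = Sat-rename σ φ ρ ×-⇔ Sat-rename σ ψ ρ
    Sat-rename σ (φ ∨' ψ)   ρ = Sat-rename σ φ ρ ⊎-⇔ Sat-rename σ ψ ρ
    Sat-rename σ (φ ⇒' ψ)   ρ = →-cong-⇔ (Sat-rename σ φ ρ) (Sat-rename σ ψ ρ)
    Sat-rename σ (∀' φ)     ρ = mk⇔ (λ h c → to (Sat-rename-lift σ φ ρ c) (h c))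
                                    (λ h c → from (Sat-rename-lift σ φ ρ c) (h c))
    Sat-rename σ (∃' φ)     ρ = mk⇔ (λ (c , h) → c , to (Sat-rename-lift σ φ ρ c) h)
                                    (λ (c , h) → c , from (Sat-rename-lift σ φ ρ c) h)

    Sat-rename-lift σ φ ρ c = ⇔-trans (Sat-rename (lift σ) φ (c ∷ ρ))
      (≡⇒ (cong (λ v → Sat L M φ (c ∷ v)) (sym (map-∘ (lookup (c ∷ ρ)) suc σ))))

    Sat-reindex : (f : Reindexing a b) → Natural f → (φ : Formula L a) (ρ : Vec Carrier b) →
                  Sat L M (reindex f φ) ρ ⇔ Sat L M φ (f ρ)
    Sat-reindex {b = b} f f-natural φ ρ = ⇔-trans (Sat-rename (f (allFin b)) φ ρ)
      (≡⇒ (cong (Sat L M φ) (trans (f-natural (lookup ρ) (allFin b)) (cong f (map-lookup-allFin ρ)))))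

    UniformlyDefines : Formula L (n + m) → Formula L (m + k * m) → Set
    UniformlyDefines {n} {m} {k} φ ψ =
      ∀ (B : List (Vec Carrier m)) → Unique B → 2 ≤ length B → ∀ (a : Vec Carrier n) →
      ∃[ cs ] ((∀ i → lookup cs i ∈ B) × Defines L M {n} {m} {k} φ ψ cs B a)

    uniformlyDefines-zero : (φ : Formula L (0 + m)) →
                            UniformlyDefines {0} {m} {0} φ (reindex (take m) φ)
    uniformlyDefines-zero {m = m} φ B _ _ [] = [] , (λ ()) , λ b _ →
      ⇔-trans (Sat-reindex (take m) take-natural φ (b ++ [])) (≡⇒ (cong (Sat L M φ) (take-++ b [])))

    definesOnImage : {φ : Formula L (n + m′)} {ψ : Formula L (m′ + k * m′)} →
      UniformlyDefines {n} {m′} {k} φ ψ →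
      (f : Vec Carrier m → Vec Carrier m′) → Injective _≡_ _≡_ f →
      (B : List (Vec Carrier m)) → Unique B → 2 ≤ length B → (a : Vec Carrier n) →
      ∃[ bs ] ((∀ i → lookup bs i ∈ B) ×
               (∀ b → b ∈ B → Sat L M ψ (f b ++ concat (map f bs)) ⇔ Sat L M φ (a ++ f b)))
    definesOnImage ψ-defines f f-injective B B-unique B-large a
      with ψ-defines (List.map f B) (Unique.map⁺ f-injective B-unique)
                     (subst (2 ≤_) (sym (length-map f B)) B-large) a
    ... | cs , cs∈ , cs-defines with lookups-∈-map⁻ f cs cs∈
    ... | bs , bs∈ , refl = bs , bs∈ , λ b b∈ → cs-defines (f b) (∈-map⁺ f b∈)

    uniformlyDefines-suc :
      {φ : Formula L (suc n + m)} {ψ : Formula L ((n + m) + k * (n + m))}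
      {ψ₂ : Formula L ((m + k * m) + k₂ * (m + k * m))} →
      UniformlyDefines {1} {n + m} {k} φ ψ →
      UniformlyDefines {n} {m + k * m} {k₂} (reindex (prependToBlocks n m k) ψ) ψ₂ →
      UniformlyDefines {suc n} {m} {k + k₂} φ (reindex (appendToBlocks m k k₂) ψ₂)
    uniformlyDefines-suc {n = n} {m = m} {k = k} {k₂ = k₂} {φ = φ} {ψ = ψ} {ψ₂ = ψ₂}
                         ψ-defines ψ₂-defines B B-unique B-large (a₀ ∷ a)
      with definesOnImage {φ = φ} {ψ = ψ} ψ-defines
                          (a ++_) (++-injectiveʳ a a) B B-unique B-large (a₀ ∷ [])
    ... | bs , bs∈ , bs-defines
      with definesOnImage {φ = reindex (prependToBlocks n m k) ψ} {ψ = ψ₂} ψ₂-defines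
                          (_++ concat bs) (λ {x} {y} → ++-injectiveˡ x y) B B-unique B-large a
    ... | ds , ds∈ , ds-defines =
      bs ++ ds , lookup-++⁺ (_∈ B) bs ds bs∈ ds∈ , λ b b∈ → begin
      Sat L M (reindex (appendToBlocks m k k₂) ψ₂) (b ++ concat (bs ++ ds))
        ∼⟨ Sat-reindex (appendToBlocks m k k₂) (appendToBlocks-natural {m = m} {k = k} {k₂ = k₂}) ψ₂ _ ⟩
      Sat L M ψ₂ (appendToBlocks m k k₂ (b ++ concat (bs ++ ds)))
        ≡⟨ cong (Sat L M ψ₂) (appendToBlocks-++ b bs ds) ⟩
      Sat L M ψ₂ ((b ++ concat bs) ++ concat (map (_++ concat bs) ds))
        ∼⟨ ds-defines b b∈ ⟩
      Sat L M (reindex (prependToBlocks n m k) ψ) (a ++ (b ++ concat bs))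
        ∼⟨ Sat-reindex (prependToBlocks n m k) (prependToBlocks-natural {n = n} {m = m} {k = k}) ψ _ ⟩
      Sat L M ψ (prependToBlocks n m k (a ++ (b ++ concat bs)))
        ≡⟨ cong (Sat L M ψ) (prependToBlocks-++ a b bs) ⟩
      Sat L M ψ ((a ++ b) ++ concat (map (a ++_) bs))
        ∼⟨ bs-defines b b∈ ⟩
      Sat L M φ (a₀ ∷ a ++ b) ∎
      where open EquationalReasoning

lemma2p6 : ExcludedMiddle 0ℓ →
    (L : Language) (M : Structure L) →
    ((m : ℕ) (φ : Formula L (1 + m)) → UDTFS L M 1 m φ) →
    (n m : ℕ) (φ : Formula L (n + m)) → UDTFS L M n m φ
lemma2p6 _ L M unary zero m φ = 0 , reindex (take m) φ , uniformlyDefines-zero M φ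
lemma2p6 em L M unary (suc n) m φ with unary (n + m) φ
... | k , ψ , ψ-defines
  with lemma2p6 em L M unary n (m + k * m) (reindex (prependToBlocks n m k) ψ)
... | k₂ , ψ₂ , ψ₂-defines =
  k + k₂ , reindex (appendToBlocks m k k₂) ψ₂ ,
  uniformlyDefines-suc M {φ = φ} {ψ = ψ} {ψ₂ = ψ₂} ψ-defines ψ₂-defines
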